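{- Let $H$ be a Hadamard matrix of order $n$, $L$ a Latin square of order $n$ on the symbols $[n]$, and $A$ an $n\times n$ $\pm1$-matrix. For $\ell\in[n]$ let $C_\ell$ be the $n\times n$ matrix with $C_\ell(i,j)=H(\ell,i)H(\ell,j)$. Let $M$ be the $n^2\times n^2$ matrix consisting of $n\times n$ blocks of size $n\times n$ whose $(i,j)$-block is $A(i,j)\,C_{L(i,j)}$, for $i,j\in[n]$. Then $M$ is a Hadamard matrix. Moreover, if $H$ is normalized and $A$ is $1$-compatible with $L$, then $(J-M)/2$ is the incidence matrix of a symmetric $(n^2,n(n-1)/2,n(n-2)/4)$ design.
   Context: A Hadamard matrix of order $n$ is an $n\times n$ $\pm1$-matrix $H$ with $HH^\top=nI$; it is normalized if all entries of its first row and first column are $+1$. A Latin square of order $n$ is an $n\times n$ array on symbols $[n]$ in which every row and every column contains each symbol once. $A$ is $1$-compatible with $L$ if $A(i,j)=1$ whenever $L(i,j)=1$. $J$ is the all-ones $n^2\times n^2$ matrix. The incidence matrix of a symmetric $(v,k,\lambda)$ design is a $v\times v$ $\{0,1\}$-matrix in which every row and column has exactly $k$ ones and the dot product of any two distinct rows, and of any two distinct columns, equals $\lambda$. -}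

module Defs where

open import Data.Nat as ℕ using (ℕ; zero; suc; _∸_)
open import Data.Integer as ℤ using (ℤ; +_; -_; _+_; _*_)
open import Data.Fin using (Fin; zero; suc; quotRem; _≟_)
open import Relation.Nullary using (yes; no)
open import Data.Unit using (⊤)
open import Data.Product using (Σ; _×_; _,_; ∃!)
open import Data.Sum using (_⊎_)
open import Relation.Binary.PropositionalEquality using (_≡_; _≢_)

-- An m × k integer matrix, indexed from 0 (index i represents row i+1).
Matrix : ℕ → ℕ → Set
Matrix m k = Fin m → Fin k → ℤ

∑ : ∀ {n} → (Fin n → ℤ) → ℤ
∑ {zero}  f = + 0
∑ {suc n} f = f zero + ∑ (λ i → f (suc i))

transpose : ∀ {m k} → Matrix m k → Matrix k m
transpose A i j = A j i

_⊗_ : ∀ {m k l} → Matrix m k → Matrix k l → Matrix m l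
(A ⊗ B) i j = ∑ (λ t → A i t * B t j)

scalarId : ∀ n → Matrix n n
scalarId n i j with i ≟ j
... | yes _ = + n
... | no  _ = + 0

IsPM1 : ∀ {m k} → Matrix m k → Set
IsPM1 A = ∀ i j → (A i j ≡ + 1) ⊎ (A i j ≡ - + 1)

IsHadamard : ∀ n → Matrix n n → Set
IsHadamard n H = IsPM1 H × (∀ i j → (H ⊗ transpose H) i j ≡ scalarId n i j)

IsNormalized : ∀ {n} → Matrix n n → Set
IsNormalized {zero}  H = ⊤
IsNormalized {suc n} H = (∀ j → H zero j ≡ + 1) × (∀ i → H i zero ≡ + 1)

-- Latin square of order n on symbols [n] (symbol s+1 represented by s : Fin n):
-- each symbol occurs exactly once in every row and in every column.
IsLatin : ∀ n → (Fin n → Fin n → Fin n) → Set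
IsLatin n L = (∀ i s → ∃! _≡_ (λ j → L i j ≡ s))
            × (∀ j s → ∃! _≡_ (λ i → L i j ≡ s))

-- A is 1-compatible with L: A(i,j) = 1 whenever L(i,j) = 1 (symbol 1 = zero).
OneCompatible : ∀ {n} → Matrix n n → (Fin n → Fin n → Fin n) → Set
OneCompatible {zero}  A L = ⊤
OneCompatible {suc n} A L = ∀ i j → L i j ≡ zero → A i j ≡ + 1

C : ∀ {n} → Matrix n n → Fin n → Matrix n n
C H ℓ i j = H ℓ i * H ℓ j

-- The n² × n² block matrix whose (i,j)-block is A(i,j) C_{L(i,j)}.
-- Row index p ∈ Fin (n*n) corresponds to block i and in-block row a with
-- p = i*n + a, i.e. quotRem n p = (a , i).
blockM : ∀ n → Matrix n n → (Fin n → Fin n → Fin n) → Matrix n n → Matrix (n ℕ.* n) (n ℕ.* n)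
blockM n H L A p q with quotRem n p | quotRem n q
... | a , i | b , j = A i j * C H (L i j) a b

Jmat : ∀ m → Matrix m m
Jmat m i j = + 1

IsSymDesignIncidence : ∀ v → ℕ → ℕ → Matrix v v → Set
IsSymDesignIncidence v k lam N =
    (∀ i j → (N i j ≡ + 0) ⊎ (N i j ≡ + 1))
  × (∀ i → ∑ (λ j → N i j) ≡ + k)
  × (∀ j → ∑ (λ i → N i j) ≡ + k)
  × (∀ i i′ → i ≢ i′ → ∑ (λ j → N i j * N i′ j) ≡ + lam)
  × (∀ j j′ → j ≢ j′ → ∑ (λ i → N i j * N i j′) ≡ + lam)

{-# OPTIONS --safe #-}

-- Let C_ℓ = h_ℓ h_ℓᵀ for the rows h_ℓ of H.  Orthogonality of the rows of H gives C_ℓ C_mᵀ = n δ_ℓm C_ℓ, and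
-- orthogonality of its columns gives Σ_ℓ C_ℓ = nI.  The columns are orthogonal because ‖Y − nI‖² depends only
-- on ‖Y‖² and tr Y, which agree for Y = HᵀH and Y = HHᵀ, so ‖HᵀH − nI‖² = ‖HHᵀ − nI‖² = 0.
-- Block (i, j) of MMᵀ is then Σ_k A_ik A_jk n δ(L_ik, L_jk) C_{L_ik}: it vanishes for i ≠ j since the columns
-- of L are injective, and for i = j it is n Σ_ℓ C_ℓ = n²I since the rows of L are permutations.
-- If the first row of H is all ones, C_ℓ has row sums n δ_ℓ1 H(ℓ, ·), and 1-compatibility makes every row and
-- column sum of M equal to n.  For a Hadamard matrix of order v with all line sums r, the 0/1 matrix (J − M)/2
-- has line sums (v − r)/2, and expanding (1 − x)(1 − y) shows that two distinct rows (or columns) share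
-- (v − 2r)/4 ones.

module Submission where

open import Defs
open import Data.Nat as ℕ using (ℕ; _∸_; _/_)
open import Data.Integer as ℤ using (ℤ; +_; _-_; _*_)
open import Data.Fin using (Fin)
open import Data.Product using (Σ; _×_)
open import Relation.Binary.PropositionalEquality using (_≡_)

open import Data.Nat using (zero; suc; z≤n)
import Data.Nat.Properties as ℕₚ
open import Data.Nat.DivMod using (m*n/n≡m)
open import Data.Integer using (-_; _+_; _≤_; +≤+; -[1+_]; -1ℤ)
open import Data.Integer.Properties
  using ( +-*-semiring; +-identityˡ; +-identityʳ; +-comm; *-comm; *-identityˡ; *-identityʳ; *-zeroʳ
        ; +-assoc; *-assoc; suc-*; pos-*; +-injective; ≤-refl; +-mono-≤; i*j≡0⇒i≡0∨j≡0
        ; i≡j⇒i-j≡0; i-j≡0⇒i≡j; -1*i≡-i )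
open import Data.Integer.Tactic.RingSolver using (solve-∀)
import Algebra.Properties.Semiring.Sum +-*-semiring as Sum
open import Data.Fin using (zero; suc; combine; remQuot; quotRem; _↑ˡ_; _↑ʳ_)
open import Data.Fin.Properties
  using (_≟_; remQuot-combine; combine-remQuot; combine-injectiveˡ; combine-injectiveʳ)
open import Data.Fin.Permutation using (Permutation′; permutation; _⟨$⟩ʳ_)
open import Data.Product using (_,_; proj₁; proj₂; swap; ∃!)
open import Data.Sum using (_⊎_; inj₁; inj₂; reduce)
open import Data.Empty using (⊥-elim)
open import Function using (_∘_)
open import Relation.Nullary using (yes; no)
open import Relation.Binary.PropositionalEquality
  using (_≢_; refl; sym; trans; cong; cong₂; subst; subst₂; module ≡-Reasoning)
open ≡-Reasoning

-- Integer arithmetic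

IsUnit : ℤ → Set
IsUnit x = (x ≡ + 1) ⊎ (x ≡ - + 1)

IsUnit-* : ∀ {x y} → IsUnit x → IsUnit y → IsUnit (x * y)
IsUnit-* (inj₁ refl) (inj₁ refl) = inj₁ refl
IsUnit-* (inj₁ refl) (inj₂ refl) = inj₂ refl
IsUnit-* (inj₂ refl) (inj₁ refl) = inj₂ refl
IsUnit-* (inj₂ refl) (inj₂ refl) = inj₁ refl

IsUnit⇒x*x≡1 : ∀ {x} → IsUnit x → x * x ≡ + 1
IsUnit⇒x*x≡1 (inj₁ refl) = refl
IsUnit⇒x*x≡1 (inj₂ refl) = refl

0≤i*i : ∀ i → + 0 ≤ i * i
0≤i*i (+ zero)   = +≤+ z≤n
0≤i*i (+ suc _)  = +≤+ z≤n
0≤i*i -[1+ _ ]   = +≤+ z≤n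

i*i≡0⇒i≡0 : ∀ i → i * i ≡ + 0 → i ≡ + 0
i*i≡0⇒i≡0 i i*i≡0 = reduce (i*j≡0⇒i≡0∨j≡0 i i*i≡0)

i+j≡0⇒i≡0 : ∀ {i j} → + 0 ≤ i → + 0 ≤ j → i + j ≡ + 0 → i ≡ + 0
i+j≡0⇒i≡0 (+≤+ _) (+≤+ _) i+j≡0 = cong +_ (ℕₚ.m+n≡0⇒m≡0 _ (+-injective i+j≡0))

d*x≡a-b⇒x≡[a∸b]/d : ∀ d {x} a b .{{_ : ℕ.NonZero d}} →
                    + 0 ≤ x → + d * x ≡ + a - + b → x ≡ + ((a ∸ b) / d)
d*x≡a-b⇒x≡[a∸b]/d d {+ k} a b _ dk≡a-b = cong +_ (sym (begin
  (a ∸ b) / d              ≡⟨ cong (λ m → (m ∸ b) / d) a≡dk+b ⟩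
  (d ℕ.* k ℕ.+ b ∸ b) / d  ≡⟨ cong (_/ d) (ℕₚ.m+n∸n≡m (d ℕ.* k) b) ⟩
  (d ℕ.* k) / d            ≡⟨ cong (_/ d) (ℕₚ.*-comm d k) ⟩
  (k ℕ.* d) / d            ≡⟨ m*n/n≡m k d ⟩
  k                        ∎))
  where
  a≡dk+b : a ≡ d ℕ.* k ℕ.+ b
  a≡dk+b = +-injective (begin
    + a                ≡⟨ i-j+j≡i (+ a) (+ b) ⟨
    (+ a - + b) + + b  ≡⟨ cong (_+ + b) (trans (sym dk≡a-b) (sym (pos-* d k))) ⟩
    + (d ℕ.* k) + + b  ∎)
    where
    i-j+j≡i : ∀ i j → i - j + j ≡ i
    i-j+j≡i = solve-∀

-- Kronecker delta and finite sums

δ : ∀ {n} → Fin n → Fin n → ℤ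
δ zero    zero    = + 1
δ zero    (suc _) = + 0
δ (suc _) zero    = + 0
δ (suc i) (suc j) = δ i j

δ-refl : ∀ {n} (i : Fin n) → δ i i ≡ + 1
δ-refl zero    = refl
δ-refl (suc i) = δ-refl i

δ-≡ : ∀ {n} {i j : Fin n} → i ≡ j → δ i j ≡ + 1
δ-≡ {i = i} refl = δ-refl i

δ-≢ : ∀ {n} {i j : Fin n} → i ≢ j → δ i j ≡ + 0
δ-≢ {i = zero}  {zero}  i≢j = ⊥-elim (i≢j refl)
δ-≢ {i = zero}  {suc _} _   = refl
δ-≢ {i = suc _} {zero}  _   = refl
δ-≢ {i = suc i} {suc j} i≢j = δ-≢ (i≢j ∘ cong suc)

δ-⇔ : ∀ {m n} {i j : Fin m} {k l : Fin n} → (i ≡ j → k ≡ l) → (k ≡ l → i ≡ j) → δ i j ≡ δ k l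
δ-⇔ {i = i} {j} to from with i ≟ j
... | yes i≡j = trans (δ-≡ i≡j) (sym (δ-≡ (to i≡j)))
... | no  i≢j = trans (δ-≢ i≢j) (sym (δ-≢ (i≢j ∘ from)))

δ-*-cong : ∀ {n} {i j : Fin n} {x y} → (i ≡ j → x ≡ y) → δ i j * x ≡ δ i j * y
δ-*-cong {i = i} {j} x≡y with i ≟ j
... | yes i≡j = cong (δ i j *_) (x≡y i≡j)
... | no  i≢j = begin
  δ i j * _  ≡⟨ cong (_* _) (δ-≢ i≢j) ⟩
  + 0        ≡⟨ cong (_* _) (δ-≢ i≢j) ⟨
  δ i j * _  ∎

δ-combine : ∀ {m n} (i j : Fin m) (a b : Fin n) → δ (combine i a) (combine j b) ≡ δ i j * δ a b
δ-combine i j a b with i ≟ j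
... | yes refl = begin
  δ (combine i a) (combine i b) ≡⟨ δ-⇔ (combine-injectiveʳ i a i b) (cong (combine i)) ⟩
  δ a b                         ≡⟨ *-identityˡ (δ a b) ⟨
  + 1 * δ a b                   ≡⟨ cong (_* δ a b) (δ-refl i) ⟨
  δ i i * δ a b                 ∎
... | no i≢j = begin
  δ (combine i a) (combine j b) ≡⟨ δ-≢ (i≢j ∘ combine-injectiveˡ i a j b) ⟩
  + 0                           ≡⟨ cong (_* δ a b) (δ-≢ i≢j) ⟨
  δ i j * δ a b                 ∎

scalarId≡*δ : ∀ n (i j : Fin n) → scalarId n i j ≡ + n * δ i j
scalarId≡*δ n i j with i ≟ j
... | yes i≡j = trans (sym (*-identityʳ (+ n))) (cong (+ n *_) (sym (δ-≡ i≡j)))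
... | no  i≢j = trans (sym (*-zeroʳ (+ n))) (cong (+ n *_) (sym (δ-≢ i≢j)))

∑≗sum : ∀ {n} (f : Fin n → ℤ) → ∑ f ≡ Sum.sum f
∑≗sum {zero}  f = refl
∑≗sum {suc n} f = cong (_+_ (f zero)) (∑≗sum (f ∘ suc))

∑-cong : ∀ {n} {f g : Fin n → ℤ} → (∀ i → f i ≡ g i) → ∑ f ≡ ∑ g
∑-cong {zero}  _   = refl
∑-cong {suc n} f≗g = cong₂ _+_ (f≗g zero) (∑-cong (f≗g ∘ suc))

∑-0 : ∀ {n} → ∑ {n} (λ _ → + 0) ≡ + 0
∑-0 {zero}  = refl
∑-0 {suc n} = cong (_+_ (+ 0)) (∑-0 {n})

∑-const : ∀ {n} c → ∑ {n} (λ _ → c) ≡ + n * c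
∑-const {zero}  c = refl
∑-const {suc n} c = trans (cong (_+_ c) (∑-const {n} c)) (sym (suc-* (+ n) c))

∑-distrib-+ : ∀ {n} (f g : Fin n → ℤ) → ∑ (λ i → f i + g i) ≡ ∑ f + ∑ g
∑-distrib-+ f g = begin
  ∑ (λ i → f i + g i)        ≡⟨ ∑≗sum (λ i → f i + g i) ⟩
  Sum.sum (λ i → f i + g i)  ≡⟨ Sum.∑-distrib-+ f g ⟩
  Sum.sum f + Sum.sum g      ≡⟨ cong₂ _+_ (∑≗sum f) (∑≗sum g) ⟨
  ∑ f + ∑ g                  ∎

*-distribˡ-∑ : ∀ {n} c (f : Fin n → ℤ) → c * ∑ f ≡ ∑ (λ i → c * f i)
*-distribˡ-∑ c f = begin
  c * ∑ f                    ≡⟨ cong (c *_) (∑≗sum f) ⟩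
  c * Sum.sum f              ≡⟨ Sum.*-distribˡ-sum c f ⟩
  Sum.sum (λ i → c * f i)    ≡⟨ ∑≗sum (λ i → c * f i) ⟨
  ∑ (λ i → c * f i)          ∎

*-distribʳ-∑ : ∀ {n} c (f : Fin n → ℤ) → ∑ f * c ≡ ∑ (λ i → f i * c)
*-distribʳ-∑ c f = begin
  ∑ f * c                    ≡⟨ cong (_* c) (∑≗sum f) ⟩
  Sum.sum f * c              ≡⟨ Sum.*-distribʳ-sum c f ⟩
  Sum.sum (λ i → f i * c)    ≡⟨ ∑≗sum (λ i → f i * c) ⟨
  ∑ (λ i → f i * c)          ∎

∑-comm : ∀ {m n} (f : Fin m → Fin n → ℤ) → ∑ (λ i → ∑ (f i)) ≡ ∑ (λ j → ∑ (λ i → f i j))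
∑-comm f = begin
  ∑ (λ i → ∑ (f i))                     ≡⟨ ∑≗sum (λ i → ∑ (f i)) ⟩
  Sum.sum (λ i → ∑ (f i))               ≡⟨ Sum.sum-cong-≗ (∑≗sum ∘ f) ⟩
  Sum.sum (λ i → Sum.sum (f i))         ≡⟨ Sum.∑-comm f ⟩
  Sum.sum (λ j → Sum.sum (λ i → f i j)) ≡⟨ Sum.sum-cong-≗ (λ j → ∑≗sum (λ i → f i j)) ⟨
  Sum.sum (λ j → ∑ (λ i → f i j))       ≡⟨ ∑≗sum (λ j → ∑ (λ i → f i j)) ⟨
  ∑ (λ j → ∑ (λ i → f i j))             ∎

∑-permute : ∀ {n} (f : Fin n → ℤ) (π : Permutation′ n) → ∑ (λ i → f (π ⟨$⟩ʳ i)) ≡ ∑ f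
∑-permute f π = begin
  ∑ (λ i → f (π ⟨$⟩ʳ i))        ≡⟨ ∑≗sum (λ i → f (π ⟨$⟩ʳ i)) ⟩
  Sum.sum (λ i → f (π ⟨$⟩ʳ i))  ≡⟨ Sum.∑-permute f π ⟨
  Sum.sum f                    ≡⟨ ∑≗sum f ⟨
  ∑ f                          ∎

∑-δ : ∀ {n} (k : Fin n) (f : Fin n → ℤ) → ∑ (λ j → δ k j * f j) ≡ f k
∑-δ {suc n} zero    f = trans (cong₂ _+_ (*-identityˡ (f zero)) (∑-0 {n})) (+-identityʳ (f zero))
∑-δ {suc n} (suc k) f = trans (+-identityˡ _) (∑-δ k (f ∘ suc))

∑-δ-unique : ∀ {m n} (σ : Fin m → Fin n) {s} (u : ∃! _≡_ (λ k → σ k ≡ s)) (g : Fin m → ℤ) →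
             ∑ (λ j → δ (σ j) s * g j) ≡ g (proj₁ u)
∑-δ-unique σ {s} (k , σk≡s , unique) g = begin
  ∑ (λ j → δ (σ j) s * g j)
    ≡⟨ ∑-cong (λ j → cong (_* g j) (δ-⇔ unique (λ k≡j → subst (λ j → σ j ≡ s) k≡j σk≡s))) ⟩
  ∑ (λ j → δ k j * g j)
    ≡⟨ ∑-δ k g ⟩
  g k ∎

∑-mul : ∀ {m n} (f : Fin m → ℤ) (g : Fin n → ℤ) → ∑ f * ∑ g ≡ ∑ (λ i → ∑ (λ j → f i * g j))
∑-mul f g = trans (*-distribʳ-∑ (∑ g) f) (∑-cong (λ i → *-distribˡ-∑ (f i) g))

∑-split : ∀ m {k} (f : Fin (m ℕ.+ k) → ℤ) → ∑ f ≡ ∑ (λ i → f (i ↑ˡ k)) + ∑ (λ j → f (m ↑ʳ j))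
∑-split zero    f = sym (+-identityˡ (∑ f))
∑-split (suc m) f = trans (cong (_+_ (f zero)) (∑-split m (f ∘ suc))) (sym (+-assoc (f zero) _ _))

∑-combine : ∀ m n (f : Fin (m ℕ.* n) → ℤ) → ∑ f ≡ ∑ (λ i → ∑ (λ a → f (combine {m} {n} i a)))
∑-combine zero    n f = refl
∑-combine (suc m) n f =
  trans (∑-split n f) (cong (_+_ (∑ (λ a → f (a ↑ˡ m ℕ.* n)))) (∑-combine m n (λ p → f (n ↑ʳ p))))

∑-nonneg : ∀ {n} {f : Fin n → ℤ} → (∀ i → + 0 ≤ f i) → + 0 ≤ ∑ f
∑-nonneg {zero}  _   = ≤-refl
∑-nonneg {suc n} f≥0 = +-mono-≤ (f≥0 zero) (∑-nonneg (f≥0 ∘ suc))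

∑-nonneg≡0 : ∀ {n} {f : Fin n → ℤ} → (∀ i → + 0 ≤ f i) → ∑ f ≡ + 0 → ∀ i → f i ≡ + 0
∑-nonneg≡0             f≥0 ∑f≡0 zero    = i+j≡0⇒i≡0 (f≥0 zero) (∑-nonneg (f≥0 ∘ suc)) ∑f≡0
∑-nonneg≡0 {f = f} f≥0 ∑f≡0 (suc i) = ∑-nonneg≡0 (f≥0 ∘ suc)
  (i+j≡0⇒i≡0 (∑-nonneg (f≥0 ∘ suc)) (f≥0 zero) (trans (+-comm (∑ (f ∘ suc)) (f zero)) ∑f≡0)) i

-- Orthogonal rows imply orthogonal columns

‖_‖² : ∀ {m k} → Matrix m k → ℤ
‖ Y ‖² = ∑ (λ i → ∑ (λ j → Y i j * Y i j))

tr : ∀ {n} → Matrix n n → ℤ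
tr Y = ∑ (λ i → Y i i)

infixl 6 _-scalar_

_-scalar_ : ∀ {n} → Matrix n n → ℤ → Matrix n n
(Y -scalar c) i j = Y i j - c * δ i j

≗0⇒‖‖²≡0 : ∀ {m k} {Y : Matrix m k} → (∀ i j → Y i j ≡ + 0) → ‖ Y ‖² ≡ + 0
≗0⇒‖‖²≡0 {m} {k} Y≡0 =
  trans (∑-cong (λ i → trans (∑-cong (λ j → cong (λ y → y * y) (Y≡0 i j))) (∑-0 {k}))) (∑-0 {m})

‖‖²≡0⇒≗0 : ∀ {m k} (Y : Matrix m k) → ‖ Y ‖² ≡ + 0 → ∀ i j → Y i j ≡ + 0
‖‖²≡0⇒≗0 Y ‖Y‖²≡0 i j = i*i≡0⇒i≡0 (Y i j)
  (∑-nonneg≡0 (λ j → 0≤i*i (Y i j))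
    (∑-nonneg≡0 (λ i → ∑-nonneg (λ j → 0≤i*i (Y i j))) ‖Y‖²≡0 i) j)

∑∑-comm : ∀ {m n k l} (F : Fin m → Fin n → Fin k → Fin l → ℤ) →
          ∑ (λ i → ∑ (λ j → ∑ (λ a → ∑ (λ b → F i j a b)))) ≡
          ∑ (λ a → ∑ (λ b → ∑ (λ i → ∑ (λ j → F i j a b))))
∑∑-comm F = begin
  ∑ (λ i → ∑ (λ j → ∑ (λ a → ∑ (λ b → F i j a b))))
    ≡⟨ ∑-cong (λ i → ∑-comm (λ j a → ∑ (λ b → F i j a b))) ⟩
  ∑ (λ i → ∑ (λ a → ∑ (λ j → ∑ (λ b → F i j a b))))
    ≡⟨ ∑-comm (λ i a → ∑ (λ j → ∑ (λ b → F i j a b))) ⟩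
  ∑ (λ a → ∑ (λ i → ∑ (λ j → ∑ (λ b → F i j a b))))
    ≡⟨ ∑-cong (λ a → ∑-cong (λ i → ∑-comm (λ j b → F i j a b))) ⟩
  ∑ (λ a → ∑ (λ i → ∑ (λ b → ∑ (λ j → F i j a b))))
    ≡⟨ ∑-cong (λ a → ∑-comm (λ i b → ∑ (λ j → F i j a b))) ⟩
  ∑ (λ a → ∑ (λ b → ∑ (λ i → ∑ (λ j → F i j a b)))) ∎

‖X⊗Xᵀ‖²≡‖Xᵀ⊗X‖² : ∀ {m k} (X : Matrix m k) → ‖ X ⊗ transpose X ‖² ≡ ‖ transpose X ⊗ X ‖²
‖X⊗Xᵀ‖²≡‖Xᵀ⊗X‖² X = begin
  ∑ (λ l → ∑ (λ m → ∑ (λ a → X l a * X m a) * ∑ (λ b → X l b * X m b)))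
    ≡⟨ ∑-cong (λ l → ∑-cong (λ m → ∑-mul (λ a → X l a * X m a) (λ b → X l b * X m b))) ⟩
  ∑ (λ l → ∑ (λ m → ∑ (λ a → ∑ (λ b → (X l a * X m a) * (X l b * X m b)))))
    ≡⟨ ∑∑-comm (λ l m a b → (X l a * X m a) * (X l b * X m b)) ⟩
  ∑ (λ a → ∑ (λ b → ∑ (λ l → ∑ (λ m → (X l a * X m a) * (X l b * X m b)))))
    ≡⟨ ∑-cong (λ a → ∑-cong (λ b → ∑-cong (λ l → ∑-cong (λ m →
         regroup (X l a) (X m a) (X l b) (X m b))))) ⟩
  ∑ (λ a → ∑ (λ b → ∑ (λ l → ∑ (λ m → (X l a * X l b) * (X m a * X m b)))))
    ≡⟨ ∑-cong (λ a → ∑-cong (λ b → ∑-mul (λ l → X l a * X l b) (λ m → X m a * X m b))) ⟨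
  ∑ (λ a → ∑ (λ b → ∑ (λ l → X l a * X l b) * ∑ (λ m → X m a * X m b))) ∎
  where
  regroup : ∀ w x y z → (w * x) * (y * z) ≡ (w * y) * (x * z)
  regroup = solve-∀

tr[X⊗Xᵀ]≡tr[Xᵀ⊗X] : ∀ {m k} (X : Matrix m k) → tr (X ⊗ transpose X) ≡ tr (transpose X ⊗ X)
tr[X⊗Xᵀ]≡tr[Xᵀ⊗X] X = ∑-comm (λ l a → X l a * X l a)

∑-[y-cδ]² : ∀ {n} (y : Fin n → ℤ) c i →
            ∑ (λ j → (y j - c * δ i j) * (y j - c * δ i j)) ≡
            ∑ (λ j → y j * y j) + (- (+ 2 * c) * y i + c * c)
∑-[y-cδ]² y c i = begin
  ∑ (λ j → (y j - c * δ i j) * (y j - c * δ i j))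
    ≡⟨ ∑-cong (λ j → expand (y j) c (δ i j)) ⟩
  ∑ (λ j → y j * y j + δ i j * (- (+ 2 * c) * y j + c * c * δ i j))
    ≡⟨ ∑-distrib-+ (λ j → y j * y j) (λ j → δ i j * (- (+ 2 * c) * y j + c * c * δ i j)) ⟩
  ∑ (λ j → y j * y j) + ∑ (λ j → δ i j * (- (+ 2 * c) * y j + c * c * δ i j))
    ≡⟨ cong (_+_ (∑ (λ j → y j * y j))) (∑-δ i (λ j → - (+ 2 * c) * y j + c * c * δ i j)) ⟩
  ∑ (λ j → y j * y j) + (- (+ 2 * c) * y i + c * c * δ i i)
    ≡⟨ cong (λ d → ∑ (λ j → y j * y j) + (- (+ 2 * c) * y i + d))
            (trans (cong (c * c *_) (δ-refl i)) (*-identityʳ (c * c))) ⟩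
  ∑ (λ j → y j * y j) + (- (+ 2 * c) * y i + c * c) ∎
  where
  expand : ∀ y c d → (y - c * d) * (y - c * d) ≡ y * y + d * (- (+ 2 * c) * y + c * c * d)
  expand = solve-∀

‖-scalar‖² : ∀ {n} (Y : Matrix n n) c → ‖ Y -scalar c ‖² ≡ ‖ Y ‖² + (- (+ 2 * c) * tr Y + + n * (c * c))
‖-scalar‖² {n} Y c = begin
  ‖ Y -scalar c ‖²
    ≡⟨ ∑-cong (λ i → ∑-[y-cδ]² (Y i) c i) ⟩
  ∑ (λ i → ∑ (λ j → Y i j * Y i j) + (- (+ 2 * c) * Y i i + c * c))
    ≡⟨ ∑-distrib-+ (λ i → ∑ (λ j → Y i j * Y i j)) (λ i → - (+ 2 * c) * Y i i + c * c) ⟩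
  ‖ Y ‖² + ∑ (λ i → - (+ 2 * c) * Y i i + c * c)
    ≡⟨ cong (_+_ ‖ Y ‖²) (∑-distrib-+ (λ i → - (+ 2 * c) * Y i i) (λ _ → c * c)) ⟩
  ‖ Y ‖² + (∑ (λ i → - (+ 2 * c) * Y i i) + ∑ {n} (λ _ → c * c))
    ≡⟨ cong (_+_ ‖ Y ‖²)
            (cong₂ _+_ (*-distribˡ-∑ (- (+ 2 * c)) (λ i → Y i i)) (sym (∑-const {n} (c * c)))) ⟨
  ‖ Y ‖² + (- (+ 2 * c) * tr Y + + n * (c * c)) ∎

RowOrthogonal : ∀ n → Matrix n n → Set
RowOrthogonal n X = ∀ i j → (X ⊗ transpose X) i j ≡ scalarId n i j

RowOrthogonal⇒∑≡*δ : ∀ {n} (X : Matrix n n) → RowOrthogonal n X →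
                     ∀ i j → ∑ (λ t → X i t * X j t) ≡ + n * δ i j
RowOrthogonal⇒∑≡*δ {n} X orth i j = trans (orth i j) (scalarId≡*δ n i j)

transpose-rowOrthogonal : ∀ {n} (X : Matrix n n) → RowOrthogonal n X → RowOrthogonal n (transpose X)
transpose-rowOrthogonal {n} X orth a b = begin
  G a b
    ≡⟨ i-j≡0⇒i≡j (G a b) (+ n * δ a b) (‖‖²≡0⇒≗0 (G -scalar + n) ‖G-nI‖²≡0 a b) ⟩
  + n * δ a b
    ≡⟨ scalarId≡*δ n a b ⟨
  scalarId n a b ∎
  where
  G R : Matrix n n
  G = transpose X ⊗ X
  R = X ⊗ transpose X

  ‖G-nI‖²≡0 : ‖ G -scalar + n ‖² ≡ + 0
  ‖G-nI‖²≡0 = begin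
    ‖ G -scalar + n ‖²
      ≡⟨ ‖-scalar‖² G (+ n) ⟩
    ‖ G ‖² + (- (+ 2 * + n) * tr G + + n * (+ n * + n))
      ≡⟨ cong₂ (λ s t → s + (- (+ 2 * + n) * t + + n * (+ n * + n)))
               (‖X⊗Xᵀ‖²≡‖Xᵀ⊗X‖² X) (tr[X⊗Xᵀ]≡tr[Xᵀ⊗X] X) ⟨
    ‖ R ‖² + (- (+ 2 * + n) * tr R + + n * (+ n * + n))
      ≡⟨ ‖-scalar‖² R (+ n) ⟨
    ‖ R -scalar + n ‖²
      ≡⟨ ≗0⇒‖‖²≡0 (λ i j → i≡j⇒i-j≡0 (RowOrthogonal⇒∑≡*δ X orth i j)) ⟩
    + 0 ∎

-- The matrices C_ℓ and the block matrix

module _ {n} (H : Matrix n n) (orth : RowOrthogonal n H) where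

  ∑-C*C : ∀ ℓ m a b → ∑ (λ c → C H ℓ a c * C H m b c) ≡ H ℓ a * H m b * (+ n * δ ℓ m)
  ∑-C*C ℓ m a b = begin
    ∑ (λ c → H ℓ a * H ℓ c * (H m b * H m c))
      ≡⟨ ∑-cong (λ c → interchange (H ℓ a) (H ℓ c) (H m b) (H m c)) ⟩
    ∑ (λ c → H ℓ a * H m b * (H ℓ c * H m c))
      ≡⟨ *-distribˡ-∑ (H ℓ a * H m b) (λ c → H ℓ c * H m c) ⟨
    H ℓ a * H m b * ∑ (λ c → H ℓ c * H m c)
      ≡⟨ cong (H ℓ a * H m b *_) (RowOrthogonal⇒∑≡*δ H orth ℓ m) ⟩
    H ℓ a * H m b * (+ n * δ ℓ m) ∎
    where
    interchange : ∀ w x y z → w * x * (y * z) ≡ w * y * (x * z)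
    interchange = solve-∀

  ∑-C : ∀ a b → ∑ (λ ℓ → C H ℓ a b) ≡ + n * δ a b
  ∑-C = RowOrthogonal⇒∑≡*δ (transpose H) (transpose-rowOrthogonal H orth)

  module _ {r} (onesRow : ∀ j → H r j ≡ + 1) where

    ∑-row : ∀ ℓ → ∑ (H ℓ) ≡ + n * δ ℓ r
    ∑-row ℓ = begin
      ∑ (H ℓ)
        ≡⟨ ∑-cong (λ b → trans (sym (*-identityʳ (H ℓ b))) (cong (H ℓ b *_) (sym (onesRow b)))) ⟩
      ∑ (λ b → H ℓ b * H r b)
        ≡⟨ RowOrthogonal⇒∑≡*δ H orth ℓ r ⟩
      + n * δ ℓ r ∎

    ∑-C-line : ∀ {k} (σ : Fin k → Fin n) (α : Fin k → ℤ) → ∃! _≡_ (λ t → σ t ≡ r) →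
               (∀ t → σ t ≡ r → α t ≡ + 1) → ∀ a → ∑ (λ t → ∑ (λ b → α t * C H (σ t) a b)) ≡ + n
    ∑-C-line σ α u@(t₀ , σt₀≡r , _) α≡1 a = begin
      ∑ (λ t → ∑ (λ b → α t * (H (σ t) a * H (σ t) b)))
        ≡⟨ ∑-cong (λ t → trans (sym (*-distribˡ-∑ (α t) (λ b → H (σ t) a * H (σ t) b)))
                               (cong (α t *_) (sym (*-distribˡ-∑ (H (σ t) a) (H (σ t)))))) ⟩
      ∑ (λ t → α t * (H (σ t) a * ∑ (H (σ t))))
        ≡⟨ ∑-cong (λ t → cong (λ s → α t * (H (σ t) a * s)) (∑-row (σ t))) ⟩
      ∑ (λ t → α t * (H (σ t) a * (+ n * δ (σ t) r)))
        ≡⟨ ∑-cong (λ t → regroup (α t) (H (σ t) a) (+ n) (δ (σ t) r)) ⟩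
      ∑ (λ t → δ (σ t) r * (α t * H (σ t) a * + n))
        ≡⟨ ∑-δ-unique σ u (λ t → α t * H (σ t) a * + n) ⟩
      α t₀ * H (σ t₀) a * + n
        ≡⟨ cong₂ (λ x y → x * y * + n) (α≡1 t₀ σt₀≡r) (trans (cong (λ ℓ → H ℓ a) σt₀≡r) (onesRow a)) ⟩
      + 1 * + 1 * + n
        ≡⟨ *-identityˡ (+ n) ⟩
      + n ∎
      where
      regroup : ∀ x h m d → x * (h * (m * d)) ≡ d * (x * h * m)
      regroup = solve-∀

module _ {n} {L : Fin n → Fin n → Fin n} (latin : IsLatin n L) where

  latinRow : Fin n → Permutation′ n
  latinRow i = permutation (L i) (λ s → proj₁ (rows i s))
    (λ s → proj₁ (proj₂ (rows i s))) (λ j → proj₂ (proj₂ (rows i (L i j))) refl)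
    where rows = proj₁ latin

  latin-δ-column : ∀ i j k → δ (L i k) (L j k) ≡ δ i j
  latin-δ-column i j k = δ-⇔ injective (cong (λ i → L i k))
    where
    injective : L i k ≡ L j k → i ≡ j
    injective Lik≡Ljk with proj₂ latin k (L j k)
    ... | _ , _ , unique = trans (sym (unique Lik≡Ljk)) (unique refl)

quotRem-combine : ∀ {m} n (i : Fin m) (a : Fin n) → quotRem n (combine i a) ≡ (a , i)
quotRem-combine n i a = cong swap (remQuot-combine i a)

∀-combine : ∀ {m n} {P : Fin (m ℕ.* n) → Set} → (∀ i a → P (combine i a)) → ∀ p → P p
∀-combine {m} {n} {P} h p =
  subst P (combine-remQuot {m} n p) (h (proj₁ (remQuot {m} n p)) (proj₂ (remQuot {m} n p)))

∀-combine₂ : ∀ {m n} {P : Fin (m ℕ.* n) → Fin (m ℕ.* n) → Set} →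
             (∀ i a j b → P (combine i a) (combine j b)) → ∀ p q → P p q
∀-combine₂ {m} {n} {P} h =
  ∀-combine {m} {n} {λ p → ∀ q → P p q} (λ i a → ∀-combine {m} {n} (h i a))

module _ {n} (H : Matrix n n) (L : Fin n → Fin n → Fin n) (A : Matrix n n) where

  blockM-combine : ∀ i a j b → blockM n H L A (combine i a) (combine j b) ≡ A i j * C H (L i j) a b
  blockM-combine i a j b rewrite quotRem-combine n i a | quotRem-combine n j b = refl

  blockM-isPM1 : IsPM1 H → IsPM1 A → IsPM1 (blockM n H L A)
  blockM-isPM1 unitH unitA = ∀-combine₂ {n} {n} {λ p q → IsUnit (blockM n H L A p q)} λ i a j b →
    subst IsUnit (sym (blockM-combine i a j b))
      (IsUnit-* (unitA i j) (IsUnit-* (unitH (L i j) a) (unitH (L i j) b)))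

  blockM-rowInner : RowOrthogonal n H → IsLatin n L → IsPM1 A → ∀ i a j b →
                    ∑ (λ q → blockM n H L A (combine i a) q * blockM n H L A (combine j b) q) ≡
                    δ i j * (+ n * (+ n * δ a b))
  blockM-rowInner orth latin unitA i a j b = begin
    ∑ (λ q → M (combine i a) q * M (combine j b) q)
      ≡⟨ ∑-combine n n (λ q → M (combine i a) q * M (combine j b) q) ⟩
    ∑ (λ (k : Fin n) → ∑ (λ (c : Fin n) →
      M (combine i a) (combine k c) * M (combine j b) (combine k c)))
      ≡⟨ ∑-cong (λ k → ∑-cong (λ c → cong₂ _*_ (blockM-combine i a k c) (blockM-combine j b k c))) ⟩
    ∑ (λ k → ∑ (λ c → A i k * C H (L i k) a c * (A j k * C H (L j k) b c)))
      ≡⟨ ∑-cong (λ k → ∑-cong (λ c → interchange (A i k) (C H (L i k) a c) (A j k) (C H (L j k) b c))) ⟩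
    ∑ (λ k → ∑ (λ c → A i k * A j k * (C H (L i k) a c * C H (L j k) b c)))
      ≡⟨ ∑-cong (λ k → *-distribˡ-∑ (A i k * A j k) (λ c → C H (L i k) a c * C H (L j k) b c)) ⟨
    ∑ (λ k → A i k * A j k * ∑ (λ c → C H (L i k) a c * C H (L j k) b c))
      ≡⟨ ∑-cong (λ k → cong (A i k * A j k *_) (∑-C*C H orth (L i k) (L j k) a b)) ⟩
    ∑ (λ k → A i k * A j k * (H (L i k) a * H (L j k) b * (+ n * δ (L i k) (L j k))))
      ≡⟨ ∑-cong (λ k → cong (λ d → A i k * A j k * (H (L i k) a * H (L j k) b * (+ n * d)))
                            (latin-δ-column latin i j k)) ⟩
    ∑ (λ k → A i k * A j k * (H (L i k) a * H (L j k) b * (+ n * δ i j)))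
      ≡⟨ ∑-cong (λ k → regroup (A i k * A j k) (H (L i k) a * H (L j k) b) (+ n) (δ i j)) ⟩
    ∑ (λ k → δ i j * + n * (A i k * A j k * (H (L i k) a * H (L j k) b)))
      ≡⟨ *-distribˡ-∑ (δ i j * + n) (λ k → A i k * A j k * (H (L i k) a * H (L j k) b)) ⟨
    δ i j * + n * ∑ (λ k → A i k * A j k * (H (L i k) a * H (L j k) b))
      ≡⟨ *-assoc (δ i j) (+ n) _ ⟩
    δ i j * (+ n * ∑ (λ k → A i k * A j k * (H (L i k) a * H (L j k) b)))
      ≡⟨ δ-*-cong {i = i} {j} (cong (+ n *_) ∘ diagonal {i} {j}) ⟩
    δ i j * (+ n * (+ n * δ a b)) ∎
    where
    M : Matrix (n ℕ.* n) (n ℕ.* n)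
    M = blockM n H L A

    interchange : ∀ w x y z → w * x * (y * z) ≡ w * y * (x * z)
    interchange = solve-∀

    regroup : ∀ x h m d → x * (h * (m * d)) ≡ d * m * (x * h)
    regroup = solve-∀

    diagonal : ∀ {i j} → i ≡ j → ∑ (λ k → A i k * A j k * (H (L i k) a * H (L j k) b)) ≡ + n * δ a b
    diagonal {i} refl = begin
      ∑ (λ k → A i k * A i k * C H (L i k) a b)
        ≡⟨ ∑-cong (λ k → trans (cong (_* C H (L i k) a b) (IsUnit⇒x*x≡1 (unitA i k))) (*-identityˡ _)) ⟩
      ∑ (λ k → C H (L i k) a b)
        ≡⟨ ∑-permute (λ ℓ → C H ℓ a b) (latinRow latin i) ⟩
      ∑ (λ ℓ → C H ℓ a b)
        ≡⟨ ∑-C H orth a b ⟩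
      + n * δ a b ∎

  blockM-rowOrthogonal : RowOrthogonal n H → IsLatin n L → IsPM1 A → RowOrthogonal (n ℕ.* n) (blockM n H L A)
  blockM-rowOrthogonal orth latin unitA =
    ∀-combine₂ {n} {n} {λ p q → (M ⊗ transpose M) p q ≡ scalarId (n ℕ.* n) p q} (λ i a j b → begin
      (M ⊗ transpose M) (combine i a) (combine j b)  ≡⟨ blockM-rowInner orth latin unitA i a j b ⟩
      δ i j * (+ n * (+ n * δ a b))                  ≡⟨ regroup (δ i j) (+ n) (δ a b) ⟩
      + n * + n * (δ i j * δ a b)                    ≡⟨ cong₂ _*_ (pos-* n n) (δ-combine i j a b) ⟨
      + (n ℕ.* n) * δ (combine i a) (combine j b)    ≡⟨ scalarId≡*δ (n ℕ.* n) (combine i a) (combine j b) ⟨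
      scalarId (n ℕ.* n) (combine i a) (combine j b) ∎)
    where
    M : Matrix (n ℕ.* n) (n ℕ.* n)
    M = blockM n H L A

    regroup : ∀ d m e → d * (m * (m * e)) ≡ m * m * (d * e)
    regroup = solve-∀

  blockM-isHadamard : IsHadamard n H → IsLatin n L → IsPM1 A → IsHadamard (n ℕ.* n) (blockM n H L A)
  blockM-isHadamard (unitH , orth) latin unitA =
    blockM-isPM1 unitH unitA , blockM-rowOrthogonal orth latin unitA

  module _ (orth : RowOrthogonal n H) (latin : IsLatin n L) {r} (onesRow : ∀ j → H r j ≡ + 1)
           (compatible : ∀ i j → L i j ≡ r → A i j ≡ + 1) where

    blockM-rowSum : ∀ p → ∑ (blockM n H L A p) ≡ + n
    blockM-rowSum = ∀-combine {n} {n} {λ p → ∑ (blockM n H L A p) ≡ + n} λ i a → begin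
      ∑ (blockM n H L A (combine i a))
        ≡⟨ ∑-combine n n (blockM n H L A (combine i a)) ⟩
      ∑ (λ (j : Fin n) → ∑ (λ (b : Fin n) → blockM n H L A (combine i a) (combine j b)))
        ≡⟨ ∑-cong (λ j → ∑-cong (λ b → blockM-combine i a j b)) ⟩
      ∑ (λ j → ∑ (λ b → A i j * C H (L i j) a b))
        ≡⟨ ∑-C-line H orth onesRow (L i) (A i) (proj₁ latin i r) (compatible i) a ⟩
      + n ∎

    blockM-colSum : ∀ q → ∑ (λ p → blockM n H L A p q) ≡ + n
    blockM-colSum = ∀-combine {n} {n} {λ q → ∑ (λ p → blockM n H L A p q) ≡ + n} λ j b → begin
      ∑ (λ p → blockM n H L A p (combine j b))
        ≡⟨ ∑-combine n n (λ p → blockM n H L A p (combine j b)) ⟩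
      ∑ (λ (i : Fin n) → ∑ (λ (a : Fin n) → blockM n H L A (combine i a) (combine j b)))
        ≡⟨ ∑-cong (λ i → ∑-cong (λ a → trans (blockM-combine i a j b)
                                              (cong (A i j *_) (*-comm (H (L i j) a) (H (L i j) b))))) ⟩
      ∑ (λ i → ∑ (λ a → A i j * C H (L i j) b a))
        ≡⟨ ∑-C-line H orth onesRow (λ i → L i j) (λ i → A i j) (proj₂ latin j r) (λ i → compatible i j) b ⟩
      + n ∎

-- Symmetric designs from regular Hadamard matrices

∑-neg : ∀ {n} (f : Fin n → ℤ) → ∑ (λ i → - f i) ≡ - ∑ f
∑-neg f = begin
  ∑ (λ i → - f i)       ≡⟨ ∑-cong (λ i → -1*i≡-i (f i)) ⟨
  ∑ (λ i → -1ℤ * f i)   ≡⟨ *-distribˡ-∑ -1ℤ f ⟨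
  -1ℤ * ∑ f             ≡⟨ -1*i≡-i (∑ f) ⟩
  - ∑ f                 ∎

∑-[1-f] : ∀ {n} (f : Fin n → ℤ) → ∑ (λ i → + 1 - f i) ≡ + n - ∑ f
∑-[1-f] {n} f = begin
  ∑ (λ i → + 1 - f i)
    ≡⟨ ∑-distrib-+ (λ _ → + 1) (λ i → - f i) ⟩
  ∑ {n} (λ _ → + 1) + ∑ (λ i → - f i)
    ≡⟨ cong₂ _+_ (trans (∑-const {n} (+ 1)) (*-identityʳ (+ n))) (∑-neg f) ⟩
  + n - ∑ f ∎

-- (1 − x)/2 on the entries x = ±1 of a Hadamard matrix, i.e. the entry of (J − M)/2.
negIndicator : ℤ → ℤ
negIndicator (+ _)    = + 0
negIndicator -[1+ _ ] = + 1

negIndicator-01 : ∀ x → (negIndicator x ≡ + 0) ⊎ (negIndicator x ≡ + 1)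
negIndicator-01 (+ _)    = inj₁ refl
negIndicator-01 -[1+ _ ] = inj₂ refl

0≤negIndicator : ∀ x → + 0 ≤ negIndicator x
0≤negIndicator (+ _)    = ≤-refl
0≤negIndicator -[1+ _ ] = +≤+ z≤n

0≤negIndicator*negIndicator : ∀ x y → + 0 ≤ negIndicator x * negIndicator y
0≤negIndicator*negIndicator (+ _)    _ = ≤-refl
0≤negIndicator*negIndicator -[1+ _ ] y = subst (+ 0 ≤_) (sym (*-identityˡ (negIndicator y))) (0≤negIndicator y)

IsUnit⇒2*negIndicator≡1-x : ∀ {x} → IsUnit x → + 2 * negIndicator x ≡ + 1 - x
IsUnit⇒2*negIndicator≡1-x (inj₁ refl) = refl
IsUnit⇒2*negIndicator≡1-x (inj₂ refl) = refl

∑-negIndicator : ∀ {k} (x : Fin k → ℤ) → (∀ q → IsUnit (x q)) →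
                 + 2 * ∑ (λ q → negIndicator (x q)) ≡ + k - ∑ x
∑-negIndicator x unit = begin
  + 2 * ∑ (λ q → negIndicator (x q))   ≡⟨ *-distribˡ-∑ (+ 2) (λ q → negIndicator (x q)) ⟩
  ∑ (λ q → + 2 * negIndicator (x q))   ≡⟨ ∑-cong (λ q → IsUnit⇒2*negIndicator≡1-x (unit q)) ⟩
  ∑ (λ q → + 1 - x q)                  ≡⟨ ∑-[1-f] x ⟩
  + _ - ∑ x                            ∎

∑-negIndicator-* : ∀ {k} (x y : Fin k → ℤ) → (∀ q → IsUnit (x q)) → (∀ q → IsUnit (y q)) →
                   + 4 * ∑ (λ q → negIndicator (x q) * negIndicator (y q)) ≡
                   + k - ∑ x - ∑ y + ∑ (λ q → x q * y q)
∑-negIndicator-* {k} x y unitX unitY = begin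
  + 4 * ∑ (λ q → negIndicator (x q) * negIndicator (y q))
    ≡⟨ *-distribˡ-∑ (+ 4) (λ q → negIndicator (x q) * negIndicator (y q)) ⟩
  ∑ (λ q → + 4 * (negIndicator (x q) * negIndicator (y q)))
    ≡⟨ ∑-cong (λ q → trans (regroup (negIndicator (x q)) (negIndicator (y q)))
                           (cong₂ _*_ (IsUnit⇒2*negIndicator≡1-x (unitX q))
                                      (IsUnit⇒2*negIndicator≡1-x (unitY q)))) ⟩
  ∑ (λ q → (+ 1 - x q) * (+ 1 - y q))
    ≡⟨ ∑-cong (λ q → expand (x q) (y q)) ⟩
  ∑ (λ q → (+ 1 - x q) - y q + x q * y q)
    ≡⟨ ∑-distrib-+ (λ q → (+ 1 - x q) - y q) (λ q → x q * y q) ⟩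
  ∑ (λ q → (+ 1 - x q) - y q) + ∑ (λ q → x q * y q)
    ≡⟨ cong (_+ ∑ (λ q → x q * y q)) (∑-distrib-+ (λ q → + 1 - x q) (λ q → - y q)) ⟩
  ∑ (λ q → + 1 - x q) + ∑ (λ q → - y q) + ∑ (λ q → x q * y q)
    ≡⟨ cong (_+ ∑ (λ q → x q * y q)) (cong₂ _+_ (∑-[1-f] x) (∑-neg y)) ⟩
  + k - ∑ x - ∑ y + ∑ (λ q → x q * y q) ∎
  where
  regroup : ∀ a b → + 4 * (a * b) ≡ (+ 2 * a) * (+ 2 * b)
  regroup = solve-∀
  expand : ∀ a b → (+ 1 - a) * (+ 1 - b) ≡ (+ 1 - a) - b + a * b
  expand = solve-∀

module _ {v} (r : ℕ) (X : Matrix v v) (unit : IsPM1 X) (∑X≡r : ∀ p → ∑ (X p) ≡ + r) where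

  negIndicator-rowSum : ∀ p → ∑ (λ q → negIndicator (X p q)) ≡ + ((v ∸ r) / 2)
  negIndicator-rowSum p = d*x≡a-b⇒x≡[a∸b]/d 2 v r (∑-nonneg (λ q → 0≤negIndicator (X p q)))
    (trans (∑-negIndicator (X p) (unit p)) (cong (_-_ (+ v)) (∑X≡r p)))

  negIndicator-rowInner : RowOrthogonal v X → ∀ p p′ → p ≢ p′ →
    ∑ (λ q → negIndicator (X p q) * negIndicator (X p′ q)) ≡ + ((v ∸ 2 ℕ.* r) / 4)
  negIndicator-rowInner orth p p′ p≢p′ = d*x≡a-b⇒x≡[a∸b]/d 4 v (2 ℕ.* r)
    (∑-nonneg (λ q → 0≤negIndicator*negIndicator (X p q) (X p′ q))) (begin
      + 4 * ∑ (λ q → negIndicator (X p q) * negIndicator (X p′ q))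
        ≡⟨ ∑-negIndicator-* (X p) (X p′) (unit p) (unit p′) ⟩
      + v - ∑ (X p) - ∑ (X p′) + ∑ (λ q → X p q * X p′ q)
        ≡⟨ cong₂ (λ s t → + v - s - t + ∑ (λ q → X p q * X p′ q)) (∑X≡r p) (∑X≡r p′) ⟩
      + v - + r - + r + ∑ (λ q → X p q * X p′ q)
        ≡⟨ cong (_+_ (+ v - + r - + r)) (RowOrthogonal⇒∑≡*δ X orth p p′) ⟩
      + v - + r - + r + + v * δ p p′
        ≡⟨ cong (λ d → + v - + r - + r + + v * d) (δ-≢ p≢p′) ⟩
      + v - + r - + r + + v * + 0
        ≡⟨ simplify (+ v) (+ r) ⟩
      + v - + 2 * + r
        ≡⟨ cong (_-_ (+ v)) (pos-* 2 r) ⟨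
      + v - + (2 ℕ.* r) ∎)
    where
    simplify : ∀ v r → v - r - r + v * + 0 ≡ v - + 2 * r
    simplify = solve-∀

regularHadamard⇒symmetricDesign : ∀ {v} r (M : Matrix v v) → IsHadamard v M →
  (∀ p → ∑ (M p) ≡ + r) → (∀ q → ∑ (λ p → M p q) ≡ + r) →
  IsSymDesignIncidence v ((v ∸ r) / 2) ((v ∸ 2 ℕ.* r) / 4) (λ p q → negIndicator (M p q))
regularHadamard⇒symmetricDesign r M (unit , orth) rowSum colSum =
    (λ p q → negIndicator-01 (M p q))
  , negIndicator-rowSum r M unit rowSum
  , negIndicator-rowSum r (transpose M) unitᵀ colSum
  , negIndicator-rowInner r M unit rowSum orth
  , negIndicator-rowInner r (transpose M) unitᵀ colSum (transpose-rowOrthogonal M orth)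
  where
  unitᵀ : IsPM1 (transpose M)
  unitᵀ p q = unit q p

blockM-regular : ∀ {n} (H : Matrix n n) L A → IsHadamard n H → IsLatin n L →
                 IsNormalized H → OneCompatible A L →
                 (∀ p → ∑ (blockM n H L A p) ≡ + n) × (∀ q → ∑ (λ p → blockM n H L A p q) ≡ + n)
blockM-regular {zero}  _ _ _ _ _ _ _ = (λ ()) , (λ ())
blockM-regular {suc _} H L A (_ , orth) latin (onesRow , _) compatible =
  blockM-rowSum H L A orth latin onesRow compatible , blockM-colSum H L A orth latin onesRow compatible

lemma6p2 : (n : ℕ) (H : Matrix n n) (L : Fin n → Fin n → Fin n) (A : Matrix n n)
    → IsHadamard n H → IsLatin n L → IsPM1 A
    → IsHadamard (n ℕ.* n) (blockM n H L A)
      × (IsNormalized H → OneCompatible A L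
         → Σ (Matrix (n ℕ.* n) (n ℕ.* n)) (λ N →
             (∀ p q → + 2 * N p q ≡ Jmat (n ℕ.* n) p q - blockM n H L A p q)
             × IsSymDesignIncidence (n ℕ.* n) ((n ℕ.* (n ∸ 1)) / 2) ((n ℕ.* (n ∸ 2)) / 4) N))
lemma6p2 n H L A hadamardH latin unitA = hadamardM , λ normalized compatible →
    N
  , (λ p q → IsUnit⇒2*negIndicator≡1-x (proj₁ hadamardM p q))
  , subst₂ (λ k l → IsSymDesignIncidence (n ℕ.* n) (k / 2) (l / 4) N) n*n∸n≡n*[n∸1] n*n∸2n≡n*[n∸2]
      (regularHadamard⇒symmetricDesign n M hadamardM
        (proj₁ (blockM-regular H L A hadamardH latin normalized compatible))
        (proj₂ (blockM-regular H L A hadamardH latin normalized compatible)))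
  where
  M N : Matrix (n ℕ.* n) (n ℕ.* n)
  M = blockM n H L A
  N p q = negIndicator (M p q)

  hadamardM : IsHadamard (n ℕ.* n) M
  hadamardM = blockM-isHadamard H L A hadamardH latin unitA

  n*n∸n≡n*[n∸1] : n ℕ.* n ∸ n ≡ n ℕ.* (n ∸ 1)
  n*n∸n≡n*[n∸1] = trans (cong (n ℕ.* n ∸_) (sym (ℕₚ.*-identityʳ n))) (sym (ℕₚ.*-distribˡ-∸ n n 1))

  n*n∸2n≡n*[n∸2] : n ℕ.* n ∸ 2 ℕ.* n ≡ n ℕ.* (n ∸ 2)
  n*n∸2n≡n*[n∸2] = trans (cong (n ℕ.* n ∸_) (ℕₚ.*-comm 2 n)) (sym (ℕₚ.*-distribˡ-∸ n n 2))
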